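{- For every integer $n\ge 0$ the following hold: \begin{itemize} \item $v(0)=0$; \item $v(2n+1)=v(n)$; \item $v(4n+2)=v(2n)+v(n)+b(n)-1$; \item $v(4n+4)=v(2n+2)+v(n)+b(n)-1$. \end{itemize} (In particular these conditions determine the function $v$ recursively.)
   Context: Let $\Sigma^*$ be the free monoid of finite words over the alphabet $\{0,1,2\}$ (including the empty word), with concatenation as product. A word $x_0x_1\cdots x_k\in\Sigma^*$ with $x_0\neq 0$ is a hyperbinary expansion of the nonnegative integer $\sum_{i=0}^k x_i2^{k-i}$; by convention the empty word is the unique hyperbinary expansion of $0$. Let $\mathcal{H}(n)$ be the set of hyperbinary expansions of $n$ and $b(n)=|\mathcal{H}(n)|$. The edge-labeled directed graph $A(n)$ has vertex set $\mathcal{H}(n)$; its arcs are all pairs $(u,w)$ of elements of $\mathcal{H}(n)$ of one of the forms: $(\mathbf{x}02\mathbf{y},\mathbf{x}10\mathbf{y})$ or $(2\mathbf{y},10\mathbf{y})$ with $\mathbf{x},\mathbf{y}\in\Sigma^*$, labeled $\to$; or $(\mathbf{x}12\mathbf{y},\mathbf{x}20\mathbf{y})$ with $\mathbf{x},\mathbf{y}\in\Sigma^*$, labeled $\twoheadrightarrow$. The cyclomatic number $v(n)$ of $A(n)$ is (number of arcs) $-$ (number of vertices) $+$ (number of connected components of the underlying undirected graph). -}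

module Defs where

open import Data.Bool using (Bool; true; false; _∧_; _∨_; not; if_then_else_)
open import Data.Nat using (ℕ; zero; suc; _+_; _*_; _≡ᵇ_)
open import Data.Integer using (ℤ; +_; _-_) renaming (_+_ to _+ℤ_)
open import Data.List using (List; []; _∷_; _++_; map; concatMap; filter; filterᵇ;
  length; upTo; deduplicate; foldr)
open import Data.Bool.ListAction using (any)
open import Data.List.Properties using (≡-dec)
open import Data.Product using (_×_; _,_)
open import Data.Product.Properties
  renaming (≡-dec to ×-≡-dec)
open import Relation.Binary.PropositionalEquality using (_≡_; refl)
open import Relation.Binary.Definitions using (DecidableEquality)
open import Relation.Nullary using (yes; no; does)

data Digit : Set where
  d0 d1 d2 : Digit

digitVal : Digit → ℕ
digitVal d0 = 0
digitVal d1 = 1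
digitVal d2 = 2

_≟D_ : DecidableEquality Digit
d0 ≟D d0 = yes refl
d0 ≟D d1 = no λ ()
d0 ≟D d2 = no λ ()
d1 ≟D d0 = no λ ()
d1 ≟D d1 = yes refl
d1 ≟D d2 = no λ ()
d2 ≟D d0 = no λ ()
d2 ≟D d1 = no λ ()
d2 ≟D d2 = yes refl

Word : Set
Word = List Digit

_≟W_ : DecidableEquality Word
_≟W_ = ≡-dec _≟D_

-- value of x₀x₁⋯x_k is Σ x_i 2^(k-i) (Horner scheme, most significant first)
value : Word → ℕ
value = go 0
  where
  go : ℕ → Word → ℕ
  go acc []      = acc
  go acc (d ∷ w) = go (2 * acc + digitVal d) w

leadingOK : Word → Bool
leadingOK []       = true
leadingOK (d0 ∷ _) = false
leadingOK (_  ∷ _) = true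

isHyp : ℕ → Word → Bool
isHyp n w = leadingOK w ∧ (value w ≡ᵇ n)

wordsOfLength : ℕ → List Word
wordsOfLength zero    = [] ∷ []
wordsOfLength (suc k) = concatMap (λ w → (d0 ∷ w) ∷ (d1 ∷ w) ∷ (d2 ∷ w) ∷ []) (wordsOfLength k)

-- H(n): every hyperbinary expansion of n has length ≤ n
-- (a word of length k+1 with nonzero leading digit has value ≥ 2^k ≥ k+1),
-- so we filter all words of length 0..n.  The resulting list has no repetitions.
H : ℕ → List Word
H n = filterᵇ (isHyp n) (concatMap wordsOfLength (upTo (suc n)))

b : ℕ → ℕ
b n = length (H n)

splits : Word → List (Word × Word)
splits []      = ([] , []) ∷ []
splits (a ∷ u) = ([] , a ∷ u) ∷ map (λ { (x , r) → (a ∷ x , r) }) (splits u)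

stepAt : Word × Word → List Word
stepAt (x , d0 ∷ d2 ∷ y) = (x ++ d1 ∷ d0 ∷ y) ∷ []
stepAt (x , d1 ∷ d2 ∷ y) = (x ++ d2 ∷ d0 ∷ y) ∷ []
stepAt _                 = []

leadStep : Word → List Word
leadStep (d2 ∷ y) = (d1 ∷ d0 ∷ y) ∷ []
leadStep _        = []

succs : Word → List Word
succs u = leadStep u ++ concatMap stepAt (splits u)

_∈ᵇ_ : Word → List Word → Bool
w ∈ᵇ ws = any (λ v → does (w ≟W v)) ws

_≟P_ : DecidableEquality (Word × Word)
_≟P_ = ×-≡-dec _≟W_ _≟W_

arcs : ℕ → List (Word × Word)
arcs n = deduplicate _≟P_
  (filterᵇ (λ { (u , w) → w ∈ᵇ H n })
    (concatMap (λ u → map (u ,_) (succs u)) (H n)))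

adjacent : Word → Word → Bool
adjacent u w = (w ∈ᵇ succs u) ∨ (u ∈ᵇ succs w)

expand : List Word → List Word → List Word
expand V S = S ++ filterᵇ (λ w → not (w ∈ᵇ S) ∧ any (adjacent w) S) V

-- iterate expansion; with fuel |V| this gives the whole component
closure : ℕ → List Word → List Word → List Word
closure zero    V S = S
closure (suc k) V S = closure k V (expand V S)

countComponents : ℕ → List Word → ℕ
countComponents zero    V        = 0
countComponents (suc k) []       = 0
countComponents (suc k) (u ∷ V') =
  suc (countComponents k
        (filterᵇ (λ w → not (w ∈ᵇ closure (length (u ∷ V')) (u ∷ V') (u ∷ []))) V'))

components : ℕ → ℕ
components n = countComponents (length (H n)) (H n)

v : ℕ → ℤ
v n = (+ length (arcs n)) - (+ b n) +ℤ (+ components n)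

{-# OPTIONS --safe #-}
module Submission where

-- The expansions of 2n+1 are those of n followed by 1, and every arc of A(2n+1) comes from
-- an arc of A(n), so A(2n+1) ≅ A(n).  The expansions of 4n+2 are y2 (y ∈ H(2n)) and x10
-- (x ∈ H(n)); an arc of A(4n+2) either keeps these endings, and is then an arc of A(2n) or of
-- A(n), or turns the final 2 of y2 into 10, which happens exactly once for each x ∈ H(n)
-- (y = x0, or y empty if x is).  Likewise A(4n+4) consists of A(2n+2)·0 and A(n)·12 joined
-- by the b(n) arcs x12 → x20.  Induction along these decompositions shows that every A(n) is
-- connected, so v(n) = #arcs − b(n) + 1, and the recurrences follow by counting.

-- ℕ addition is written _+_ inside this module; the theorem at the end uses _+_ for ℤ.
module HyperbinaryGraph where

  open import Defs
  open import Data.Bool using (Bool; T; true; false; not; _∧_)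
  open import Data.Bool.ListAction using (any)
  open import Data.Bool.Properties using (T-∧; T-∨; T-≡)
  open import Data.Empty using (⊥-elim)
  open import Data.Nat using (ℕ; zero; suc; _+_; _*_; _≤_; _<_; s≤s; z≤n; z<s)
  open import Data.Nat.Induction using (<-rec)
  open import Data.Nat.Properties
  open import Data.Nat.Tactic.RingSolver using (solve-∀)
  open import Data.List
    using (List; []; _∷_; _++_; _∷ʳ_; initLast; _∷ʳ′_; map; length; concatMap; upTo; drop; filter
          ; filterᵇ)
  open import Data.List.Properties
    using ( ∷ʳ-injectiveˡ; ∷ʳ-injectiveʳ; ++-conicalʳ; ++-identityʳ; length-++; length-map; length-filter
          ; filter-none; concatMap-map; concatMap-cong; map-concatMap )
  open import Data.List.Membership.Propositional using (_∈_; _∉_; find; lose)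
  open import Data.List.Membership.Propositional.Properties
    using ( ∈-++⁺ˡ; ∈-++⁺ʳ; ∈-++⁻; ++-∈⇔; ∈-map⁺; ∈-map⁻; map-∈↔; ∈-concatMap⁺
          ; ∈-concatMap⁻; ∈-filter⁺; ∈-filter⁻; ∈-upTo⁺; deduplicate-∈⇔; ∈-length )
  open import Data.List.Membership.Propositional.Properties.WithK using (unique∧set⇒bag)
  open import Data.List.Relation.Binary.BagAndSetEquality using (∼bag⇒↭)
  open import Data.List.Relation.Binary.Permutation.Propositional.Properties using (↭-length)
  open import Data.List.Relation.Unary.Any using (here; there)
  import Data.List.Relation.Unary.Any as Any
  open import Data.List.Relation.Unary.Any.Properties using (any⇔; any⁺)
  import Data.List.Relation.Unary.All as All
  import Data.List.Relation.Unary.All.Properties as All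
  import Data.List.Relation.Unary.AllPairs as AllPairs
  import Data.List.Relation.Unary.AllPairs.Properties as AllPairs
  open import Data.List.Relation.Unary.Unique.Propositional using (Unique)
  import Data.List.Relation.Unary.Unique.Propositional.Properties as Unique
  open import Data.List.Relation.Unary.Unique.DecPropositional.Properties using (deduplicate-!)
  open import Data.Product using (∃; ∃-syntax; _×_; _,_; proj₁; proj₂; uncurry)
  import Data.Product as Product
  open import Data.Sum using (_⊎_; inj₁; inj₂)
  import Data.Sum as Sum
  open import Function.Base using (_∘_)
  open import Function.Bundles using (_⇔_; mk⇔; Equivalence)
  open import Function.Construct.Composition using (_⇔-∘_)
  open import Function.Construct.Symmetry using (⇔-sym)
  open import Function.Definitions using (Injective)
  open import Function.Properties.Inverse using (↔⇒⇔)
  open import Level using (0ℓ)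
  open import Relation.Binary.Core using (_=[_]⇒_; _⇒_)
  open import Relation.Binary.Construct.Closure.Equivalence using (EqClosure)
  import Relation.Binary.Construct.Closure.Equivalence as EqClosure
  open import Relation.Binary.Construct.Closure.ReflexiveTransitive using (Star; ε; _◅_; _◅◅_)
  import Relation.Binary.Construct.Closure.ReflexiveTransitive as Star
  open import Relation.Binary.Construct.Closure.Symmetric using (SymClosure; fwd; bwd)
  open import Relation.Binary.PropositionalEquality
    using (_≡_; _≢_; refl; sym; trans; cong; cong₂; subst; module ≡-Reasoning)
  open import Relation.Nullary using (¬_)
  open import Relation.Nullary.Decidable using (T?; yes; no; does)
  open import Relation.Unary using (Pred; Decidable; _∪_; _⊆_; _≐_)

  open Equivalence using (to; from)

  private variable
    A B C : Set
    P Q : Pred A 0ℓ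
    j k m n : ℕ
    d : Digit
    u w x y : Word

  -- Counting finite sets

  record HasSize {A : Set} (P : Pred A 0ℓ) (k : ℕ) : Set where
    field
      elements : List A
      unique   : Unique elements
      ∈⇔       : ∀ {x} → x ∈ elements ⇔ P x
      length≡  : length elements ≡ k

  open HasSize

  Image : (A → B) → Pred A 0ℓ → Pred B 0ℓ
  Image f P y = ∃[ x ] P x × y ≡ f x

  size-unique : HasSize P j → HasSize P k → j ≡ k
  size-unique {j = j} {k = k} p q = begin
    j                   ≡⟨ length≡ p ⟨
    length (elements p) ≡⟨ ↭-length (∼bag⇒↭ (unique∧set⇒bag (unique p) (unique q) same-elements)) ⟩
    length (elements q) ≡⟨ length≡ q ⟩
    k                   ∎
    where
    open ≡-Reasoning
    same-elements : ∀ {x} → x ∈ elements p ⇔ x ∈ elements q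
    same-elements = ⇔-sym (∈⇔ q) ⇔-∘ ∈⇔ p

  size-resp : P ≐ Q → HasSize P k → HasSize Q k
  size-resp (P⊆Q , Q⊆P) p = record
    { elements = elements p
    ; unique   = unique p
    ; ∈⇔       = mk⇔ (P⊆Q ∘ to (∈⇔ p)) (from (∈⇔ p) ∘ Q⊆P)
    ; length≡  = length≡ p
    }

  size-image : {f : A → B} → Injective _≡_ _≡_ f → HasSize P k → HasSize (Image f P) k
  size-image {f = f} f-injective p = record
    { elements = map f (elements p)
    ; unique   = Unique.map⁺ f-injective (unique p)
    ; ∈⇔       = mk⇔ (λ y∈ → let (x , x∈ , eq) = from map-∈⇔ y∈ in x , to (∈⇔ p) x∈ , eq)
                     (λ (x , px , eq) → to map-∈⇔ (x , from (∈⇔ p) px , eq))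
    ; length≡  = trans (length-map f (elements p)) (length≡ p)
    }
    where
    map-∈⇔ : ∀ {y} → (∃[ x ] x ∈ elements p × y ≡ f x) ⇔ y ∈ map f (elements p)
    map-∈⇔ = ↔⇒⇔ (map-∈↔ f)

  size-∪ : (∀ {x} → P x → ¬ Q x) → HasSize P j → HasSize Q k → HasSize (P ∪ Q) (j + k)
  size-∪ disjoint p q = record
    { elements = elements p ++ elements q
    ; unique   = Unique.++⁺ (unique p) (unique q)
                   (λ (x∈p , x∈q) → disjoint (to (∈⇔ p) x∈p) (to (∈⇔ q) x∈q))
    ; ∈⇔       = mk⇔ (Sum.map (to (∈⇔ p)) (to (∈⇔ q))) (Sum.map (from (∈⇔ p)) (from (∈⇔ q)))
                 ⇔-∘ ++-∈⇔
    ; length≡  = trans (length-++ (elements p)) (cong₂ _+_ (length≡ p) (length≡ q))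
    }

  images-disjoint : {f : A → C} {g : B → C} {P : Pred A 0ℓ} {Q : Pred B 0ℓ} →
                    (∀ x y → f x ≢ g y) → ∀ {z} → Image f P z → ¬ Image g Q z
  images-disjoint f≢g (x , _ , refl) (y , _ , eq) = f≢g x y eq

  image⁻ : {f : A → B} → Injective _≡_ _≡_ f → ∀ {x} → Image f P (f x) → P x
  image⁻ {P = P} f-injective (y , py , eq) = subst P (sym (f-injective eq)) py

  ∪-image⁻ˡ : {f g : A → B} → Injective _≡_ _≡_ f → (∀ x y → f x ≢ g y) →
              ∀ {x} → (Image f P ∪ Image g Q) (f x) → P x
  ∪-image⁻ˡ f-injective f≢g = Sum.[ image⁻ f-injective , (λ (y , _ , eq) → ⊥-elim (f≢g _ y eq)) ]

  ∪-image⁻ʳ : {f g : A → B} → Injective _≡_ _≡_ g → (∀ x y → f x ≢ g y) →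
              ∀ {y} → (Image f P ∪ Image g Q) (g y) → Q y
  ∪-image⁻ʳ g-injective f≢g = Sum.[ (λ (x , _ , eq) → ⊥-elim (f≢g x _ (sym eq))) , image⁻ g-injective ]

  concatMap-unique : {f : A → List B} (g : B → A) → (∀ {x y} → y ∈ f x → g y ≡ x) →
                     (∀ x → Unique (f x)) → {xs : List A} → Unique xs → Unique (concatMap f xs)
  concatMap-unique {f = f} g g-inverts f-unique xs-unique =
    Unique.concat⁺ (All.map⁺ (All.universal f-unique _)) (AllPairs.map⁺ (AllPairs.map disjoint xs-unique))
    where
    disjoint : ∀ {x y} → x ≢ y → ∀ {z} → ¬ (z ∈ f x × z ∈ f y)
    disjoint x≢y (z∈fx , z∈fy) = x≢y (trans (sym (g-inverts z∈fx)) (g-inverts z∈fy))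

  module _ {P Q : Pred A 0ℓ} (P? : Decidable P) (Q? : Decidable Q) (Q⊆P : Q ⊆ P) where

    filter-length-mono : ∀ xs → length (filter Q? xs) ≤ length (filter P? xs)
    filter-length-mono []       = z≤n
    filter-length-mono (x ∷ xs) with Q? x | P? x
    ... | yes _  | yes _  = s≤s (filter-length-mono xs)
    ... | yes qx | no ¬px = ⊥-elim (¬px (Q⊆P qx))
    ... | no  _  | yes _  = m≤n⇒m≤1+n (filter-length-mono xs)
    ... | no  _  | no  _  = filter-length-mono xs

    filter-length-strict : ∀ {x xs} → x ∈ xs → P x → ¬ Q x → length (filter Q? xs) < length (filter P? xs)
    filter-length-strict {xs = y ∷ xs} (here refl) px ¬qx with Q? y | P? y
    ... | yes qx | _      = ⊥-elim (¬qx qx)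
    ... | no  _  | yes _  = s≤s (filter-length-mono xs)
    ... | no  _  | no ¬px = ⊥-elim (¬px px)
    filter-length-strict {xs = y ∷ xs} (there x∈) px ¬qx with Q? y | P? y
    ... | yes _  | yes _  = s≤s (filter-length-strict x∈ px ¬qx)
    ... | yes qy | no ¬py = ⊥-elim (¬py (Q⊆P qy))
    ... | no  _  | yes _  = m≤n⇒m≤1+n (filter-length-strict x∈ px ¬qx)
    ... | no  _  | no  _  = filter-length-strict x∈ px ¬qx

  -- `Defs.value` is `go 0` for a function `go` local to its where block.  The
  -- metavariable below is solved by unification with that `go` (the `with`
  -- turns the accumulator into a variable), which exposes it to induction.
  mutual
    horner : ℕ → Word → ℕ
    horner = _

    value≡horner : ∀ w → value w ≡ horner 0 w
    value≡horner w with 0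
    ... | _ = refl

  horner-++ : ∀ a u w → horner a (u ++ w) ≡ horner (horner a u) w
  horner-++ a []      w = refl
  horner-++ a (d ∷ u) w = horner-++ (2 * a + digitVal d) u w

  value-∷ʳ : ∀ u d → value (u ∷ʳ d) ≡ 2 * value u + digitVal d
  value-∷ʳ u d = trans (value≡horner (u ∷ʳ d)) (horner-++ 0 u (d ∷ []))

  horner-≥ : ∀ a w → 1 ≤ a → a + length w ≤ horner a w
  horner-≥ a []      _   = ≤-reflexive (+-identityʳ a)
  horner-≥ a (d ∷ w) 1≤a = begin
    a + suc (length w)               ≡⟨ +-suc a (length w) ⟩
    suc a + length w                 ≤⟨ +-monoˡ-≤ (length w) a<2a+d ⟩
    (2 * a + digitVal d) + length w  ≤⟨ horner-≥ (2 * a + digitVal d) w (<⇒≤ (≤-<-trans 1≤a a<2a+d)) ⟩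
    horner a (d ∷ w)                 ∎
    where
    open ≤-Reasoning
    a<2a+d : a < 2 * a + digitVal d
    a<2a+d = begin-strict
      a                   <⟨ m<m+n a 1≤a ⟩
      a + a               ≡⟨ cong (a +_) (+-identityʳ a) ⟨
      2 * a               ≤⟨ m≤m+n (2 * a) (digitVal d) ⟩
      2 * a + digitVal d  ∎

  length≤value : ∀ w → T (leadingOK w) → length w ≤ value w
  length≤value []       _ = z≤n
  length≤value (d1 ∷ w) _ = horner-≥ 1 w (s≤s z≤n)
  length≤value (d2 ∷ w) _ = ≤-trans (n≤1+n _) (horner-≥ 2 w (s≤s z≤n))

  leadingOK-∷ʳ⁻ : ∀ u → T (leadingOK (u ∷ʳ d)) → T (leadingOK u)
  leadingOK-∷ʳ⁻ []       _ = _
  leadingOK-∷ʳ⁻ (d1 ∷ _) _ = _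
  leadingOK-∷ʳ⁻ (d2 ∷ _) _ = _

  -- Hyperbinary expansions

  Expansion : ℕ → Pred Word 0ℓ
  Expansion n w = T (leadingOK w) × value w ≡ n

  isHyp⇔ : T (isHyp n w) ⇔ Expansion n w
  isHyp⇔ {n} {w} = mk⇔ (Product.map₂ (≡ᵇ⇒≡ (value w) n) ∘ to T-∧)
                       (from T-∧ ∘ Product.map₂ (≡⇒≡ᵇ (value w) n))

  prependDigit : Word → List Word
  prependDigit w = (d0 ∷ w) ∷ (d1 ∷ w) ∷ (d2 ∷ w) ∷ []

  ∈-prependDigit⁺ : ∀ d w → d ∷ w ∈ prependDigit w
  ∈-prependDigit⁺ d0 w = here refl
  ∈-prependDigit⁺ d1 w = there (here refl)
  ∈-prependDigit⁺ d2 w = there (there (here refl))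

  ∈-prependDigit⁻ : u ∈ prependDigit w → ∃[ d ] u ≡ d ∷ w
  ∈-prependDigit⁻ (here refl)                 = d0 , refl
  ∈-prependDigit⁻ (there (here refl))         = d1 , refl
  ∈-prependDigit⁻ (there (there (here refl))) = d2 , refl

  ∈-wordsOfLength⁻ : ∀ k → w ∈ wordsOfLength k → length w ≡ k
  ∈-wordsOfLength⁻ zero    (here refl) = refl
  ∈-wordsOfLength⁻ (suc k) w∈
    with u , u∈ , w∈u ← find (∈-concatMap⁻ prependDigit {xs = wordsOfLength k} w∈)
    with d , refl ← ∈-prependDigit⁻ w∈u = cong suc (∈-wordsOfLength⁻ k u∈)

  ∈-wordsOfLength⁺ : ∀ w → w ∈ wordsOfLength (length w)
  ∈-wordsOfLength⁺ []      = here refl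
  ∈-wordsOfLength⁺ (d ∷ w) =
    ∈-concatMap⁺ prependDigit {xs = wordsOfLength (length w)}
                 (lose (∈-wordsOfLength⁺ w) (∈-prependDigit⁺ d w))

  wordsOfLength-unique : ∀ k → Unique (wordsOfLength k)
  wordsOfLength-unique zero    = All.[] AllPairs.∷ AllPairs.[]
  wordsOfLength-unique (suc k) = concatMap-unique (drop 1) drop-inverts prependDigit-unique (wordsOfLength-unique k)
    where
    drop-inverts : u ∈ prependDigit w → drop 1 u ≡ w
    drop-inverts u∈ with _ , refl ← ∈-prependDigit⁻ u∈ = refl
    prependDigit-unique : ∀ w → Unique (prependDigit w)
    prependDigit-unique w = ((λ ()) All.∷ (λ ()) All.∷ All.[])
                 AllPairs.∷ ((λ ()) All.∷ All.[])
                 AllPairs.∷ All.[]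
                 AllPairs.∷ AllPairs.[]

  H-unique : ∀ n → Unique (H n)
  H-unique n = Unique.filter⁺ (T? ∘ isHyp n)
    (concatMap-unique length (∈-wordsOfLength⁻ _) wordsOfLength-unique (Unique.upTo⁺ (suc n)))

  ∈-H⇔ : w ∈ H n ⇔ Expansion n w
  ∈-H⇔ {w} {n} = mk⇔ (to isHyp⇔ ∘ proj₂ ∘ ∈-filter⁻ (T? ∘ isHyp n) {xs = candidates})
                     (λ e → ∈-filter⁺ (T? ∘ isHyp n) (short-enough e) (from isHyp⇔ e))
    where
    candidates = concatMap wordsOfLength (upTo (suc n))
    short-enough : Expansion n w → w ∈ candidates
    short-enough (leading , refl) = ∈-concatMap⁺ wordsOfLength {xs = upTo (suc n)}
      (lose (∈-upTo⁺ (s≤s (length≤value w leading))) (∈-wordsOfLength⁺ w))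

  H-size : ∀ n → HasSize (Expansion n) (b n)
  H-size n = record { elements = H n ; unique = H-unique n ; ∈⇔ = ∈-H⇔ ; length≡ = refl }

  data Move : Word → Word → Set where
    02→10 : ∀ y → Move (d0 ∷ d2 ∷ y) (d1 ∷ d0 ∷ y)
    12→20 : ∀ y → Move (d1 ∷ d2 ∷ y) (d2 ∷ d0 ∷ y)
    _∷_   : ∀ a {u w} → Move u w → Move (a ∷ u) (a ∷ w)

  data Arc : Word → Word → Set where
    2→10 : ∀ y → Arc (d2 ∷ y) (d1 ∷ d0 ∷ y)
    move : ∀ {u w} → Move u w → Arc u w

  moves : Word → List Word
  moves u = concatMap stepAt (splits u)

  stepAt-∷ : ∀ a x r → stepAt (a ∷ x , r) ≡ map (a ∷_) (stepAt (x , r))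
  stepAt-∷ a x []            = refl
  stepAt-∷ a x (d0 ∷ [])     = refl
  stepAt-∷ a x (d0 ∷ d0 ∷ r) = refl
  stepAt-∷ a x (d0 ∷ d1 ∷ r) = refl
  stepAt-∷ a x (d0 ∷ d2 ∷ r) = refl
  stepAt-∷ a x (d1 ∷ [])     = refl
  stepAt-∷ a x (d1 ∷ d0 ∷ r) = refl
  stepAt-∷ a x (d1 ∷ d1 ∷ r) = refl
  stepAt-∷ a x (d1 ∷ d2 ∷ r) = refl
  stepAt-∷ a x (d2 ∷ r)      = refl

  moves-∷ : ∀ a u → moves (a ∷ u) ≡ stepAt ([] , a ∷ u) ++ map (a ∷_) (moves u)
  moves-∷ a u = cong (stepAt ([] , a ∷ u) ++_) (begin
    concatMap stepAt (map _ (splits u))        ≡⟨ concatMap-map stepAt _ (splits u) ⟩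
    concatMap (stepAt ∘ _) (splits u)          ≡⟨ concatMap-cong (λ (x , r) → stepAt-∷ a x r) (splits u) ⟩
    concatMap (map (a ∷_) ∘ stepAt) (splits u) ≡⟨ map-concatMap (a ∷_) stepAt (splits u) ⟨
    map (a ∷_) (moves u)                       ∎)
    where open ≡-Reasoning

  stepAt-[]⁻ : ∀ r → w ∈ stepAt ([] , r) → Move r w
  stepAt-[]⁻ (d0 ∷ d2 ∷ y) (here refl) = 02→10 y
  stepAt-[]⁻ (d1 ∷ d2 ∷ y) (here refl) = 12→20 y
  stepAt-[]⁻ (d0 ∷ d2 ∷ y) (there ())
  stepAt-[]⁻ (d1 ∷ d2 ∷ y) (there ())
  stepAt-[]⁻ []            ()
  stepAt-[]⁻ (d0 ∷ [])     ()
  stepAt-[]⁻ (d0 ∷ d0 ∷ r) ()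
  stepAt-[]⁻ (d0 ∷ d1 ∷ r) ()
  stepAt-[]⁻ (d1 ∷ [])     ()
  stepAt-[]⁻ (d1 ∷ d0 ∷ r) ()
  stepAt-[]⁻ (d1 ∷ d1 ∷ r) ()
  stepAt-[]⁻ (d2 ∷ r)      ()

  ∈-moves⁻ : ∀ u → w ∈ moves u → Move u w
  ∈-moves⁻ (a ∷ u) w∈ rewrite moves-∷ a u with ∈-++⁻ (stepAt ([] , a ∷ u)) w∈
  ... | inj₁ w∈head = stepAt-[]⁻ (a ∷ u) w∈head
  ... | inj₂ w∈tail with _ , w′∈ , refl ← ∈-map⁻ (a ∷_) w∈tail = a ∷ ∈-moves⁻ u w′∈

  ∈-moves⁺ : Move u w → w ∈ moves u
  ∈-moves⁺ (02→10 y)       = here refl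
  ∈-moves⁺ (12→20 y)       = here refl
  ∈-moves⁺ (_∷_ a {u} m) rewrite moves-∷ a u =
    ∈-++⁺ʳ (stepAt ([] , a ∷ u)) (∈-map⁺ (a ∷_) (∈-moves⁺ m))

  ∈-leadStep⁻ : ∀ u → w ∈ leadStep u → Arc u w
  ∈-leadStep⁻ (d2 ∷ y) (here refl) = 2→10 y
  ∈-leadStep⁻ (d2 ∷ y) (there ())
  ∈-leadStep⁻ []       ()
  ∈-leadStep⁻ (d0 ∷ y) ()
  ∈-leadStep⁻ (d1 ∷ y) ()

  ∈-succs⇔ : w ∈ succs u ⇔ Arc u w
  ∈-succs⇔ {w} {u} = mk⇔ (Sum.[ ∈-leadStep⁻ u , move ∘ ∈-moves⁻ u ] ∘ ∈-++⁻ (leadStep u))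
                         ∈-succs⁺
    where
    ∈-succs⁺ : Arc u w → w ∈ succs u
    ∈-succs⁺ (2→10 y) = here refl
    ∈-succs⁺ (move m) = ∈-++⁺ʳ (leadStep u) (∈-moves⁺ m)

  T-≟W⇔ : T (does (u ≟W w)) ⇔ u ≡ w
  T-≟W⇔ {u} {w} with u ≟W w
  ... | yes u≡w = mk⇔ (λ _ → u≡w) _
  ... | no  u≢w = mk⇔ (λ ()) u≢w

  ∈ᵇ⇔ : ∀ {ws} → T (w ∈ᵇ ws) ⇔ w ∈ ws
  ∈ᵇ⇔ = mk⇔ (Any.map (to T-≟W⇔)) (Any.map (from T-≟W⇔)) ⇔-∘ ⇔-sym any⇔

  ∉ᵇ⇔ : ∀ w ws → T (not (w ∈ᵇ ws)) ⇔ w ∉ ws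
  ∉ᵇ⇔ w ws with w ∈ᵇ ws in eq
  ... | true  = mk⇔ (λ ()) (λ w∉ → w∉ (to ∈ᵇ⇔ (from T-≡ eq)))
  ... | false = mk⇔ (λ _ w∈ → subst T eq (from ∈ᵇ⇔ w∈)) _

  ArcOf : ℕ → Word → Word → Set
  ArcOf n u w = Expansion n u × Arc u w × Expansion n w

  Arcs : ℕ → Pred (Word × Word) 0ℓ
  Arcs n = uncurry (ArcOf n)

  ∈-arcs⇔ : ∀ {u w} → (u , w) ∈ arcs n ⇔ ArcOf n u w
  ∈-arcs⇔ {n} {u} {w} = mk⇔ arc⁻ arc⁺ ⇔-∘ ⇔-sym (deduplicate-∈⇔ _≟P_)
    where
    out : Word → List (Word × Word)
    out u = map (u ,_) (succs u)
    arc⁻ : (u , w) ∈ filterᵇ _ (concatMap out (H n)) → ArcOf n u w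
    arc⁻ p∈ with p∈out , w∈H ← ∈-filter⁻ _ {xs = concatMap out (H n)} p∈
            with u′ , u′∈H , p∈out-u′ ← find (∈-concatMap⁻ out {xs = H n} p∈out)
            with w′ , w′∈succs , refl ← ∈-map⁻ (u′ ,_) p∈out-u′
      = to ∈-H⇔ u′∈H , to ∈-succs⇔ w′∈succs , to ∈-H⇔ (to ∈ᵇ⇔ w∈H)
    arc⁺ : ArcOf n u w → (u , w) ∈ filterᵇ _ (concatMap out (H n))
    arc⁺ (eu , a , ew) = ∈-filter⁺ _ (∈-concatMap⁺ out (lose (from ∈-H⇔ eu) (∈-map⁺ (u ,_) (from ∈-succs⇔ a))))
                                     (from ∈ᵇ⇔ (from ∈-H⇔ ew))

  arcs-size : ∀ n → HasSize (Arcs n) (length (arcs n))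
  arcs-size n = record { elements = arcs n ; unique = deduplicate-! _≟P_ _ ; ∈⇔ = ∈-arcs⇔ ; length≡ = refl }

  ∷ʳ-injective₁ : ∀ (d : Digit) → Injective _≡_ _≡_ (_∷ʳ d)
  ∷ʳ-injective₁ d {x} {y} = ∷ʳ-injectiveˡ x y

  ∷ʳ-injective₂ : ∀ (a d : Digit) → Injective _≡_ _≡_ (λ x → x ∷ʳ a ∷ʳ d)
  ∷ʳ-injective₂ a d eq = ∷ʳ-injective₁ a (∷ʳ-injective₁ d eq)

  ∷ʳ-≢ : ∀ {d e : Digit} → d ≢ e → ∀ u w → u ∷ʳ d ≢ w ∷ʳ e
  ∷ʳ-≢ d≢e u w = d≢e ∘ ∷ʳ-injectiveʳ u w

  expansion-∷ʳ⁺ : Expansion k u → 2 * k + digitVal d ≡ m → m ≢ 0 → Expansion m (u ∷ʳ d)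
  expansion-∷ʳ⁺ {u = []}     {d = d0} (_ , refl) refl m≢0 = ⊥-elim (m≢0 refl)
  expansion-∷ʳ⁺ {u = []}     {d = d1} (_ , refl) refl _   = _ , refl
  expansion-∷ʳ⁺ {u = []}     {d = d2} (_ , refl) refl _   = _ , refl
  expansion-∷ʳ⁺ {u = d1 ∷ u} {d = d}  (_ , refl) refl _   = _ , value-∷ʳ (d1 ∷ u) d
  expansion-∷ʳ⁺ {u = d2 ∷ u} {d = d}  (_ , refl) refl _   = _ , value-∷ʳ (d2 ∷ u) d

  expansion-∷ʳ⁻ : Expansion m (u ∷ʳ d) → 2 * value u + digitVal d ≡ m
  expansion-∷ʳ⁻ {u = u} {d = d} (_ , eq) = trans (sym (value-∷ʳ u d)) eq

  expansion-initLast : Expansion m w → m ≢ 0 →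
    ∃[ u ] ∃[ d ] w ≡ u ∷ʳ d × T (leadingOK u) × 2 * value u + digitVal d ≡ m
  expansion-initLast {w = w} e m≢0 with initLast w
  ... | []      = ⊥-elim (m≢0 (sym (proj₂ e)))
  ... | u ∷ʳ′ d = u , d , refl , leadingOK-∷ʳ⁻ u (proj₁ e) , expansion-∷ʳ⁻ e

  move-∷ʳ : Move u w → Move (u ∷ʳ d) (w ∷ʳ d)
  move-∷ʳ (02→10 y) = 02→10 (y ∷ʳ _)
  move-∷ʳ (12→20 y) = 12→20 (y ∷ʳ _)
  move-∷ʳ (a ∷ m)   = a ∷ move-∷ʳ m

  arc-∷ʳ : Arc u w → Arc (u ∷ʳ d) (w ∷ʳ d)
  arc-∷ʳ (2→10 y) = 2→10 (y ∷ʳ _)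
  arc-∷ʳ (move m) = move (move-∷ʳ m)

  -- The arcs out of u ∷ʳ d2 that rewrite its final 2 (see carry-move).
  data Carry : Word → Word → Set where
    02→10 : ∀ x → Carry (x ∷ʳ d0) (x ∷ʳ d1 ∷ʳ d0)
    12→20 : ∀ x → Carry (x ∷ʳ d1) (x ∷ʳ d2 ∷ʳ d0)

  carry-∷ : ∀ a → Carry u w → Carry (a ∷ u) (a ∷ w)
  carry-∷ a (02→10 x) = 02→10 (a ∷ x)
  carry-∷ a (12→20 x) = 12→20 (a ∷ x)

  carry-move : Carry u w → Move (u ∷ʳ d2) w
  carry-move (02→10 [])      = 02→10 []
  carry-move (02→10 (a ∷ x)) = a ∷ carry-move (02→10 x)
  carry-move (12→20 [])      = 12→20 []
  carry-move (12→20 (a ∷ x)) = a ∷ carry-move (12→20 x)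

  move-∷ʳ⁻ : ∀ {v w′} u d → Move v w′ → v ≡ u ∷ʳ d →
             (∃[ w ] w′ ≡ w ∷ʳ d × Move u w) ⊎ (d ≡ d2 × Carry u w′)
  move-∷ʳ⁻ (d0 ∷ [])     _ (02→10 _) refl = inj₂ (refl , 02→10 [])
  move-∷ʳ⁻ (d0 ∷ d2 ∷ u) _ (02→10 _) refl = inj₁ (_ , refl , 02→10 u)
  move-∷ʳ⁻ (d1 ∷ [])     _ (12→20 _) refl = inj₂ (refl , 12→20 [])
  move-∷ʳ⁻ (d1 ∷ d2 ∷ u) _ (12→20 _) refl = inj₁ (_ , refl , 12→20 u)
  move-∷ʳ⁻ []            _ (_ ∷ ())  refl
  move-∷ʳ⁻ (a ∷ u)       d (a ∷ m)   refl with move-∷ʳ⁻ u d m refl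
  ... | inj₁ (w , refl , m′) = inj₁ (a ∷ w , refl , a ∷ m′)
  ... | inj₂ (refl , c)      = inj₂ (refl , carry-∷ a c)

  data ArcFrom∷ʳ (u : Word) (d : Digit) : Word → Set where
    lifted : ∀ {w} → Arc u w → ArcFrom∷ʳ u d (w ∷ʳ d)
    carry  : ∀ {w′} → d ≡ d2 → Carry u w′ → ArcFrom∷ʳ u d w′
    2→10   : d ≡ d2 → u ≡ [] → ArcFrom∷ʳ u d (d1 ∷ d0 ∷ [])

  arc-∷ʳ⁻ : ∀ u d {w′} → Arc (u ∷ʳ d) w′ → ArcFrom∷ʳ u d w′
  arc-∷ʳ⁻ []       d2 (2→10 []) = 2→10 refl refl
  arc-∷ʳ⁻ (d2 ∷ u) d  (2→10 _)  = lifted (2→10 u)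
  arc-∷ʳ⁻ u        d  (move m)  with move-∷ʳ⁻ u d m refl
  ... | inj₁ (_ , refl , m′) = lifted (move m′)
  ... | inj₂ (d≡d2 , c)      = carry d≡d2 c

  -- Vertices of A(2n+1), A(4n+2) and A(4n+4)

  last-digit-odd : 2 * k + digitVal d ≡ 2 * n + 1 → d ≡ d1 × k ≡ n
  last-digit-odd {k} {d0} {n} eq = ⊥-elim (even≢odd k n (trans (sym (+-identityʳ _)) (trans eq (+-comm _ 1))))
  last-digit-odd {k} {d1} {n} eq = refl , *-cancelˡ-≡ k n 2 (+-cancelʳ-≡ 1 _ _ eq)
  last-digit-odd {k} {d2} {n} eq =
    ⊥-elim (even≢odd (suc k) n (trans (*-suc 2 k) (trans (+-comm 2 _) (trans eq (+-comm _ 1)))))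

  last-digit-even : 2 * k + digitVal d ≡ 2 * m → (d ≡ d0 × k ≡ m) ⊎ (d ≡ d2 × suc k ≡ m)
  last-digit-even {k} {d0} {m} eq = inj₁ (refl , *-cancelˡ-≡ k m 2 (trans (sym (+-identityʳ _)) eq))
  last-digit-even {k} {d1} {m} eq = ⊥-elim (even≢odd m k (trans (sym eq) (+-comm _ 1)))
  last-digit-even {k} {d2} {m} eq =
    inj₂ (refl , *-cancelˡ-≡ (suc k) m 2 (trans (*-suc 2 k) (trans (+-comm 2 _) eq)))

  4n+2≡2[2n+1]+0 : ∀ n → 4 * n + 2 ≡ 2 * (2 * n + 1) + 0
  4n+2≡2[2n+1]+0 = solve-∀

  4n+2≡2[2n]+2 : ∀ n → 4 * n + 2 ≡ 2 * (2 * n) + 2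
  4n+2≡2[2n]+2 = solve-∀

  4n+4≡2[2n+2]+0 : ∀ n → 4 * n + 4 ≡ 2 * (2 * n + 2) + 0
  4n+4≡2[2n+2]+0 = solve-∀

  4n+4≡2[2n+1]+2 : ∀ n → 4 * n + 4 ≡ 2 * (2 * n + 1) + 2
  4n+4≡2[2n+1]+2 = solve-∀

  last-digit-4n+2 : 2 * k + digitVal d ≡ 4 * n + 2 → (d ≡ d2 × k ≡ 2 * n) ⊎ (d ≡ d0 × k ≡ 2 * n + 1)
  last-digit-4n+2 {k} {d} {n} eq
    with last-digit-even {k} {d} {2 * n + 1} (trans eq (trans (4n+2≡2[2n+1]+0 n) (+-identityʳ _)))
  ... | inj₁ (refl , k≡) = inj₂ (refl , k≡)
  ... | inj₂ (refl , 1+k≡) = inj₁ (refl , suc-injective (trans 1+k≡ (+-comm (2 * n) 1)))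

  last-digit-4n+4 : 2 * k + digitVal d ≡ 4 * n + 4 → (d ≡ d0 × k ≡ 2 * n + 2) ⊎ (d ≡ d2 × k ≡ 2 * n + 1)
  last-digit-4n+4 {k} {d} {n} eq
    with last-digit-even {k} {d} {2 * n + 2} (trans eq (trans (4n+4≡2[2n+2]+0 n) (+-identityʳ _)))
  ... | inj₁ (refl , k≡) = inj₁ (refl , k≡)
  ... | inj₂ (refl , 1+k≡) = inj₂ (refl , suc-injective (trans 1+k≡ (+-suc (2 * n) 1)))

  expansion-2n+1⁻ : ∀ n → Expansion (2 * n + 1) w → Image (_∷ʳ d1) (Expansion n) w
  expansion-2n+1⁻ n e
    with u , d , refl , leading , eq ← expansion-initLast e (m+1+n≢0 (2 * n))
    with refl , value≡n ← last-digit-odd {k = value u} {d = d} {n = n} eq = u , (leading , value≡n) , refl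

  expansion-2n+1 : ∀ n → Expansion (2 * n + 1) ≐ Image (_∷ʳ d1) (Expansion n)
  expansion-2n+1 n = expansion-2n+1⁻ n , λ { (x , e , refl) → expansion-∷ʳ⁺ e refl (m+1+n≢0 (2 * n)) }

  expansion-4n+2 : ∀ n → Expansion (4 * n + 2) ≐
                         Image (_∷ʳ d2) (Expansion (2 * n)) ∪ Image (λ x → x ∷ʳ d1 ∷ʳ d0) (Expansion n)
  expansion-4n+2 n = split , Sum.[ (λ { (y , e , refl) → ∷ʳ2 e }) , (λ { (x , e , refl) → ∷ʳ10 e }) ]
    where
    split : Expansion (4 * n + 2) ⊆
            Image (_∷ʳ d2) (Expansion (2 * n)) ∪ Image (λ x → x ∷ʳ d1 ∷ʳ d0) (Expansion n)
    split e with u , d , refl , leading , eq ← expansion-initLast e (m+1+n≢0 (4 * n))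
            with last-digit-4n+2 {k = value u} {d = d} {n = n} eq
    ... | inj₁ (refl , value≡) = inj₁ (u , (leading , value≡) , refl)
    ... | inj₂ (refl , value≡)
      with x , ex , refl ← expansion-2n+1⁻ n (leading , value≡) = inj₂ (x , ex , refl)
    ∷ʳ2 : Expansion (2 * n) y → Expansion (4 * n + 2) (y ∷ʳ d2)
    ∷ʳ2 e = expansion-∷ʳ⁺ e (sym (4n+2≡2[2n]+2 n)) (m+1+n≢0 (4 * n))
    ∷ʳ10 : Expansion n x → Expansion (4 * n + 2) (x ∷ʳ d1 ∷ʳ d0)
    ∷ʳ10 e =
      expansion-∷ʳ⁺ (proj₂ (expansion-2n+1 n) (_ , e , refl)) (sym (4n+2≡2[2n+1]+0 n)) (m+1+n≢0 (4 * n))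

  expansion-4n+4 : ∀ n → Expansion (4 * n + 4) ≐
                         Image (_∷ʳ d0) (Expansion (2 * n + 2)) ∪ Image (λ x → x ∷ʳ d1 ∷ʳ d2) (Expansion n)
  expansion-4n+4 n = split , Sum.[ (λ { (y , e , refl) → ∷ʳ0 e }) , (λ { (x , e , refl) → ∷ʳ12 e }) ]
    where
    split : Expansion (4 * n + 4) ⊆
            Image (_∷ʳ d0) (Expansion (2 * n + 2)) ∪ Image (λ x → x ∷ʳ d1 ∷ʳ d2) (Expansion n)
    split e with u , d , refl , leading , eq ← expansion-initLast e (m+1+n≢0 (4 * n))
            with last-digit-4n+4 {k = value u} {d = d} {n = n} eq
    ... | inj₁ (refl , value≡) = inj₁ (u , (leading , value≡) , refl)
    ... | inj₂ (refl , value≡)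
      with x , ex , refl ← expansion-2n+1⁻ n (leading , value≡) = inj₂ (x , ex , refl)
    ∷ʳ0 : Expansion (2 * n + 2) y → Expansion (4 * n + 4) (y ∷ʳ d0)
    ∷ʳ0 e = expansion-∷ʳ⁺ e (sym (4n+4≡2[2n+2]+0 n)) (m+1+n≢0 (4 * n))
    ∷ʳ12 : Expansion n x → Expansion (4 * n + 4) (x ∷ʳ d1 ∷ʳ d2)
    ∷ʳ12 e =
      expansion-∷ʳ⁺ (proj₂ (expansion-2n+1 n) (_ , e , refl)) (sym (4n+4≡2[2n+1]+2 n)) (m+1+n≢0 (4 * n))

  ∷ʳ2≢∷ʳ10 : ∀ x y → x ∷ʳ d2 ≢ y ∷ʳ d1 ∷ʳ d0
  ∷ʳ2≢∷ʳ10 x y = ∷ʳ-≢ (λ ()) x (y ∷ʳ d1)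

  ∷ʳ0≢∷ʳ12 : ∀ x y → x ∷ʳ d0 ≢ y ∷ʳ d1 ∷ʳ d2
  ∷ʳ0≢∷ʳ12 x y = ∷ʳ-≢ (λ ()) x (y ∷ʳ d1)

  b-2n+1 : ∀ n → b (2 * n + 1) ≡ b n
  b-2n+1 n = size-unique (H-size (2 * n + 1))
    (size-resp (Product.swap (expansion-2n+1 n)) (size-image (∷ʳ-injective₁ d1) (H-size n)))

  b-4n+2 : ∀ n → b (4 * n + 2) ≡ b (2 * n) + b n
  b-4n+2 n = size-unique (H-size (4 * n + 2))
    (size-resp (Product.swap (expansion-4n+2 n)) (size-∪ (images-disjoint ∷ʳ2≢∷ʳ10)
      (size-image (∷ʳ-injective₁ d2) (H-size (2 * n))) (size-image (∷ʳ-injective₂ d1 d0) (H-size n))))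

  b-4n+4 : ∀ n → b (4 * n + 4) ≡ b (2 * n + 2) + b n
  b-4n+4 n = size-unique (H-size (4 * n + 4))
    (size-resp (Product.swap (expansion-4n+4 n)) (size-∪ (images-disjoint ∷ʳ0≢∷ʳ12)
      (size-image (∷ʳ-injective₁ d0) (H-size (2 * n + 2))) (size-image (∷ʳ-injective₂ d1 d2) (H-size n))))

  -- Arcs of A(2n+1), A(4n+2) and A(4n+4)

  both : (Word → Word) → Word × Word → Word × Word
  both f = Product.map f f

  both-injective : {f : Word → Word} → Injective _≡_ _≡_ f → Injective _≡_ _≡_ (both f)
  both-injective f-injective eq = cong₂ _,_ (f-injective (cong proj₁ eq)) (f-injective (cong proj₂ eq))

  ArcOf-map : (f : Word → Word) → (∀ {x} → Expansion k x → Expansion m (f x)) →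
              (∀ {x y} → Arc x y → Arc (f x) (f y)) → ArcOf k =[ f ]⇒ ArcOf m
  ArcOf-map f expansion arc (eu , a , ew) = expansion eu , arc a , expansion ew

  double : Word → Word
  double []      = []
  double (a ∷ x) = (a ∷ x) ∷ʳ d0

  expansion-∷ʳ0⁻ : Expansion (2 * n) (x ∷ʳ d0) → Expansion n x
  expansion-∷ʳ0⁻ {n} {x} e =
    leadingOK-∷ʳ⁻ x (proj₁ e) , *-cancelˡ-≡ _ n 2 (trans (sym (+-identityʳ _)) (expansion-∷ʳ⁻ e))

  double-expansion : Expansion n x → Expansion (2 * n) (double x)
  double-expansion {x = []}    (_ , refl) = _ , refl
  double-expansion {x = a ∷ x} e@(leading , refl) =
    expansion-∷ʳ⁺ e (+-identityʳ _) (m<n⇒n≢0 (≤-trans (length≤value (a ∷ x) leading) (m≤m+n _ _)))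

  expansion-∷ʳ2 : Expansion n x → Expansion (2 * n + 2) (x ∷ʳ d2)
  expansion-∷ʳ2 {n} e = expansion-∷ʳ⁺ e refl (m+1+n≢0 (2 * n))

  bridge-4n+2 : Word → Word × Word
  bridge-4n+2 x = double x ∷ʳ d2 , x ∷ʳ d1 ∷ʳ d0

  bridge-4n+4 : Word → Word × Word
  bridge-4n+4 x = x ∷ʳ d1 ∷ʳ d2 , x ∷ʳ d2 ∷ʳ d0

  bridge-4n+2-arc : Expansion n x → Arcs (4 * n + 2) (bridge-4n+2 x)
  bridge-4n+2-arc {n} {x} e = proj₂ (expansion-4n+2 n) (inj₁ (_ , double-expansion e , refl)) , arc x ,
                              proj₂ (expansion-4n+2 n) (inj₂ (_ , e , refl))
    where
    arc : ∀ x → Arc (double x ∷ʳ d2) (x ∷ʳ d1 ∷ʳ d0)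
    arc []      = 2→10 []
    arc (a ∷ x) = move (carry-move (02→10 (a ∷ x)))

  bridge-4n+4-arc : Expansion n x → Arcs (4 * n + 4) (bridge-4n+4 x)
  bridge-4n+4-arc {n} {x} e = proj₂ (expansion-4n+4 n) (inj₂ (_ , e , refl)) , move (carry-move (12→20 x)) ,
                              proj₂ (expansion-4n+4 n) (inj₁ (_ , expansion-∷ʳ2 e , refl))

  carry-from-even : Expansion (2 * n) y → Carry y w → Image bridge-4n+2 (Expansion n) (y ∷ʳ d2 , w)
  carry-from-even (() , _) (02→10 [])
  carry-from-even e (02→10 (a ∷ x)) = a ∷ x , expansion-∷ʳ0⁻ e , refl
  carry-from-even {n} e (12→20 x) =
    ⊥-elim (even≢odd n (value x) (trans (sym (expansion-∷ʳ⁻ e)) (+-comm _ 1)))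

  carry-from-∷ʳ1 : Carry u w → u ≡ x ∷ʳ d1 → w ≡ x ∷ʳ d2 ∷ʳ d0
  carry-from-∷ʳ1 (02→10 x′) eq with () ← ∷ʳ-injectiveʳ x′ _ eq
  carry-from-∷ʳ1 (12→20 x′) eq = cong (λ x → x ∷ʳ d2 ∷ʳ d0) (∷ʳ-injectiveˡ x′ _ eq)

  arcs-2n+1 : ∀ n → Arcs (2 * n + 1) ≐ Image (both (_∷ʳ d1)) (Arcs n)
  arcs-2n+1 n = split , λ { (_ , a , refl) → ArcOf-map (_∷ʳ d1) ∷ʳ1 arc-∷ʳ a }
    where
    ∷ʳ1 : Expansion n x → Expansion (2 * n + 1) (x ∷ʳ d1)
    ∷ʳ1 e = proj₂ (expansion-2n+1 n) (_ , e , refl)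
    split : Arcs (2 * n + 1) ⊆ Image (both (_∷ʳ d1)) (Arcs n)
    split (eu′ , a , ew′) with u , eu , refl ← proj₁ (expansion-2n+1 n) eu′ with arc-∷ʳ⁻ u d1 a
    ... | lifted a′ = _ , (eu , a′ , image⁻ (∷ʳ-injective₁ d1) (proj₁ (expansion-2n+1 n) ew′)) , refl
    ... | carry () _
    ... | 2→10 () _

  arcs-4n+2 : ∀ n → Arcs (4 * n + 2) ≐ Image (both (_∷ʳ d2)) (Arcs (2 * n))
                                        ∪ Image (both (λ x → x ∷ʳ d1 ∷ʳ d0)) (Arcs n)
                                        ∪ Image bridge-4n+2 (Expansion n)
  arcs-4n+2 n = split , Sum.[ lifted₂ , Sum.[ lifted₁₀ , (λ { (_ , e , refl) → bridge-4n+2-arc e }) ] ]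
    where
    ∷ʳ2 : Expansion (2 * n) y → Expansion (4 * n + 2) (y ∷ʳ d2)
    ∷ʳ2 e = proj₂ (expansion-4n+2 n) (inj₁ (_ , e , refl))
    ∷ʳ10 : Expansion n x → Expansion (4 * n + 2) (x ∷ʳ d1 ∷ʳ d0)
    ∷ʳ10 e = proj₂ (expansion-4n+2 n) (inj₂ (_ , e , refl))
    ∷ʳ2⁻ : Expansion (4 * n + 2) (y ∷ʳ d2) → Expansion (2 * n) y
    ∷ʳ2⁻ e = ∪-image⁻ˡ (∷ʳ-injective₁ d2) ∷ʳ2≢∷ʳ10 (proj₁ (expansion-4n+2 n) e)
    ∷ʳ10⁻ : Expansion (4 * n + 2) (x ∷ʳ d1 ∷ʳ d0) → Expansion n x
    ∷ʳ10⁻ e = ∪-image⁻ʳ (∷ʳ-injective₂ d1 d0) ∷ʳ2≢∷ʳ10 (proj₁ (expansion-4n+2 n) e)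
    lifted₂ : Image (both (_∷ʳ d2)) (Arcs (2 * n)) ⊆ Arcs (4 * n + 2)
    lifted₂ (_ , a , refl) = ArcOf-map (_∷ʳ d2) ∷ʳ2 arc-∷ʳ a
    lifted₁₀ : Image (both (λ x → x ∷ʳ d1 ∷ʳ d0)) (Arcs n) ⊆ Arcs (4 * n + 2)
    lifted₁₀ (_ , a , refl) = ArcOf-map (λ x → x ∷ʳ d1 ∷ʳ d0) ∷ʳ10 (arc-∷ʳ ∘ arc-∷ʳ) a
    split : Arcs (4 * n + 2) ⊆ Image (both (_∷ʳ d2)) (Arcs (2 * n))
                               ∪ Image (both (λ x → x ∷ʳ d1 ∷ʳ d0)) (Arcs n)
                               ∪ Image bridge-4n+2 (Expansion n)
    split (eu′ , a , ew′) with proj₁ (expansion-4n+2 n) eu′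
    split (eu′ , a , ew′) | inj₁ (y , ey , refl) with arc-∷ʳ⁻ y d2 a
    ... | lifted a′       = inj₁ (_ , (ey , a′ , ∷ʳ2⁻ ew′) , refl)
    ... | carry _ c       = inj₂ (inj₂ (carry-from-even ey c))
    ... | 2→10 _ refl     = inj₂ (inj₂ ([] , (_ , *-cancelˡ-≡ 0 n 2 (proj₂ ey)) , refl))
    split (eu′ , a , ew′) | inj₂ (x , ex , refl) with arc-∷ʳ⁻ (x ∷ʳ d1) d0 a
    ... | carry () _
    ... | 2→10 () _
    ... | lifted a′ with arc-∷ʳ⁻ x d1 a′
    ...   | lifted a″ = inj₂ (inj₁ (_ , (ex , a″ , ∷ʳ10⁻ ew′) , refl))
    ...   | carry () _
    ...   | 2→10 () _

  arcs-4n+4 : ∀ n → Arcs (4 * n + 4) ≐ Image (both (_∷ʳ d0)) (Arcs (2 * n + 2))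
                                        ∪ Image (both (λ x → x ∷ʳ d1 ∷ʳ d2)) (Arcs n)
                                        ∪ Image bridge-4n+4 (Expansion n)
  arcs-4n+4 n = split , Sum.[ lifted₀ , Sum.[ lifted₁₂ , (λ { (_ , e , refl) → bridge-4n+4-arc e }) ] ]
    where
    ∷ʳ0 : Expansion (2 * n + 2) y → Expansion (4 * n + 4) (y ∷ʳ d0)
    ∷ʳ0 e = proj₂ (expansion-4n+4 n) (inj₁ (_ , e , refl))
    ∷ʳ12 : Expansion n x → Expansion (4 * n + 4) (x ∷ʳ d1 ∷ʳ d2)
    ∷ʳ12 e = proj₂ (expansion-4n+4 n) (inj₂ (_ , e , refl))
    ∷ʳ0⁻ : Expansion (4 * n + 4) (y ∷ʳ d0) → Expansion (2 * n + 2) y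
    ∷ʳ0⁻ e = ∪-image⁻ˡ (∷ʳ-injective₁ d0) ∷ʳ0≢∷ʳ12 (proj₁ (expansion-4n+4 n) e)
    ∷ʳ12⁻ : Expansion (4 * n + 4) (x ∷ʳ d1 ∷ʳ d2) → Expansion n x
    ∷ʳ12⁻ e = ∪-image⁻ʳ (∷ʳ-injective₂ d1 d2) ∷ʳ0≢∷ʳ12 (proj₁ (expansion-4n+4 n) e)
    lifted₀ : Image (both (_∷ʳ d0)) (Arcs (2 * n + 2)) ⊆ Arcs (4 * n + 4)
    lifted₀ (_ , a , refl) = ArcOf-map (_∷ʳ d0) ∷ʳ0 arc-∷ʳ a
    lifted₁₂ : Image (both (λ x → x ∷ʳ d1 ∷ʳ d2)) (Arcs n) ⊆ Arcs (4 * n + 4)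
    lifted₁₂ (_ , a , refl) = ArcOf-map (λ x → x ∷ʳ d1 ∷ʳ d2) ∷ʳ12 (arc-∷ʳ ∘ arc-∷ʳ) a
    split : Arcs (4 * n + 4) ⊆ Image (both (_∷ʳ d0)) (Arcs (2 * n + 2))
                               ∪ Image (both (λ x → x ∷ʳ d1 ∷ʳ d2)) (Arcs n)
                               ∪ Image bridge-4n+4 (Expansion n)
    split (eu′ , a , ew′) with proj₁ (expansion-4n+4 n) eu′
    split (eu′ , a , ew′) | inj₁ (y , ey , refl) with arc-∷ʳ⁻ y d0 a
    ... | lifted a′ = inj₁ (_ , (ey , a′ , ∷ʳ0⁻ ew′) , refl)
    ... | carry () _
    ... | 2→10 () _
    split (eu′ , a , ew′) | inj₂ (x , ex , refl) with arc-∷ʳ⁻ (x ∷ʳ d1) d2 a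
    ... | carry _ c   = inj₂ (inj₂ (x , ex , cong (x ∷ʳ d1 ∷ʳ d2 ,_) (carry-from-∷ʳ1 c refl)))
    ... | 2→10 _ x∷ʳ1≡[] with () ← ++-conicalʳ x (d1 ∷ []) x∷ʳ1≡[]
    ... | lifted a′ with arc-∷ʳ⁻ x d1 a′
    ...   | lifted a″ = inj₂ (inj₁ (_ , (ex , a″ , ∷ʳ12⁻ ew′) , refl))
    ...   | carry () _
    ...   | 2→10 () _

  arcCount-2n+1 : ∀ n → length (arcs (2 * n + 1)) ≡ length (arcs n)
  arcCount-2n+1 n = size-unique (arcs-size (2 * n + 1))
    (size-resp (Product.swap (arcs-2n+1 n)) (size-image (both-injective (∷ʳ-injective₁ d1)) (arcs-size n)))

  arcCount-4n+2 : ∀ n → length (arcs (4 * n + 2)) ≡ length (arcs (2 * n)) + (length (arcs n) + b n)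
  arcCount-4n+2 n = size-unique (arcs-size (4 * n + 2)) (size-resp (Product.swap (arcs-4n+2 n))
    (size-∪ (λ p → Sum.[ images-disjoint lifted≢lifted p , images-disjoint lifted≢bridge p ])
      (size-image (both-injective (∷ʳ-injective₁ d2)) (arcs-size (2 * n)))
      (size-∪ (images-disjoint lifted≢bridge′)
        (size-image (both-injective (∷ʳ-injective₂ d1 d0)) (arcs-size n))
        (size-image (∷ʳ-injective₂ d1 d0 ∘ cong proj₂) (H-size n)))))
    where
    lifted≢lifted : ∀ p q → both (_∷ʳ d2) p ≢ both (λ x → x ∷ʳ d1 ∷ʳ d0) q
    lifted≢lifted _ _ = ∷ʳ2≢∷ʳ10 _ _ ∘ cong proj₁
    lifted≢bridge : ∀ p x → both (_∷ʳ d2) p ≢ bridge-4n+2 x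
    lifted≢bridge _ _ = ∷ʳ2≢∷ʳ10 _ _ ∘ cong proj₂
    lifted≢bridge′ : ∀ p x → both (λ x → x ∷ʳ d1 ∷ʳ d0) p ≢ bridge-4n+2 x
    lifted≢bridge′ _ _ = ∷ʳ2≢∷ʳ10 _ _ ∘ sym ∘ cong proj₁

  arcCount-4n+4 : ∀ n → length (arcs (4 * n + 4)) ≡ length (arcs (2 * n + 2)) + (length (arcs n) + b n)
  arcCount-4n+4 n = size-unique (arcs-size (4 * n + 4)) (size-resp (Product.swap (arcs-4n+4 n))
    (size-∪ (λ p → Sum.[ images-disjoint lifted≢lifted p , images-disjoint lifted≢bridge p ])
      (size-image (both-injective (∷ʳ-injective₁ d0)) (arcs-size (2 * n + 2)))
      (size-∪ (images-disjoint lifted≢bridge′)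
        (size-image (both-injective (∷ʳ-injective₂ d1 d2)) (arcs-size n))
        (size-image (∷ʳ-injective₂ d2 d0 ∘ cong proj₂) (H-size n)))))
    where
    lifted≢lifted : ∀ p q → both (_∷ʳ d0) p ≢ both (λ x → x ∷ʳ d1 ∷ʳ d2) q
    lifted≢lifted _ _ = ∷ʳ0≢∷ʳ12 _ _ ∘ cong proj₁
    lifted≢bridge : ∀ p x → both (_∷ʳ d0) p ≢ bridge-4n+4 x
    lifted≢bridge _ _ = ∷ʳ0≢∷ʳ12 _ _ ∘ cong proj₁
    lifted≢bridge′ : ∀ p x → both (λ x → x ∷ʳ d1 ∷ʳ d2) p ≢ bridge-4n+4 x
    lifted≢bridge′ (_ , w) x = ∷ʳ-≢ (λ ()) (w ∷ʳ d1) (x ∷ʳ d2) ∘ cong proj₂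

  -- Connectedness

  data Shape : ℕ → Set where
    zero : Shape 0
    2n+1 : ∀ n → Shape (2 * n + 1)
    4n+2 : ∀ n → Shape (4 * n + 2)
    4n+4 : ∀ n → Shape (4 * n + 4)

  shape : ∀ m → Shape m
  shape 0 = zero
  shape 1 = 2n+1 0
  shape 2 = 4n+2 0
  shape 3 = 2n+1 1
  shape (suc (suc (suc (suc m)))) with shape m
  ... | zero   = 4n+4 0
  ... | 2n+1 n = subst Shape (shift-2n+1 n) (2n+1 (n + 2))
    where
    shift-2n+1 : ∀ n → 2 * (n + 2) + 1 ≡ 4 + (2 * n + 1)
    shift-2n+1 = solve-∀
  ... | 4n+2 n = subst Shape (shift-4n+2 n) (4n+2 (n + 1))
    where
    shift-4n+2 : ∀ n → 4 * (n + 1) + 2 ≡ 4 + (4 * n + 2)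
    shift-4n+2 = solve-∀
  ... | 4n+4 n = subst Shape (shift-4n+4 n) (4n+4 (n + 1))
    where
    shift-4n+4 : ∀ n → 4 * (n + 1) + 4 ≡ 4 + (4 * n + 4)
    shift-4n+4 = solve-∀

  shape-induction : (P : ℕ → Set) → P 0 → (∀ n → P n → P (2 * n + 1)) →
                    (∀ n → P n → P (2 * n) → P (4 * n + 2)) →
                    (∀ n → P n → P (2 * n + 2) → P (4 * n + 4)) → ∀ m → P m
  shape-induction P P0 P2n+1 P4n+2 P4n+4 = <-rec P step
    where
    2≤4 : 2 ≤ 4
    2≤4 = s≤s (s≤s z≤n)
    step : ∀ m → (∀ {k} → k < m → P k) → P m
    step m rec with shape m
    ... | zero   = P0
    ... | 2n+1 n = P2n+1 n (rec (≤-<-trans (m≤n*m n 2) (m<m+n (2 * n) z<s)))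
    ... | 4n+2 n = P4n+2 n (rec (≤-<-trans (m≤n*m n 4) (m<m+n (4 * n) z<s)))
                           (rec (≤-<-trans (*-monoˡ-≤ n 2≤4) (m<m+n (4 * n) z<s)))
    ... | 4n+4 n = P4n+4 n (rec (≤-<-trans (m≤n*m n 4) (m<m+n (4 * n) z<s)))
                           (rec (+-mono-≤-< (*-monoˡ-≤ n 2≤4) (s≤s (s≤s (s≤s z≤n)))))

  expansion-exists : ∀ n → ∃ (Expansion n)
  expansion-exists = shape-induction (∃ ∘ Expansion) ([] , _ , refl)
    (λ n (x , e) → _ , proj₂ (expansion-2n+1 n) (x , e , refl))
    (λ n (x , e) _ → _ , proj₂ (expansion-4n+2 n) (inj₂ (x , e , refl)))
    (λ n (x , e) _ → _ , proj₂ (expansion-4n+4 n) (inj₂ (x , e , refl)))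

  Connected : ℕ → Set
  Connected n = ∀ {x y} → Expansion n x → Expansion n y → EqClosure (ArcOf n) x y

  connected-via-hub : ∀ {h} → (∀ {x} → Expansion m x → EqClosure (ArcOf m) x h) → Connected m
  connected-via-hub to-hub ex ey = to-hub ex ◅◅ EqClosure.symmetric _ (to-hub ey)

  expansion-0 : Expansion 0 x → x ≡ []
  expansion-0 {[]}    _                = refl
  expansion-0 {a ∷ x} (leading , eq) with () ← ≤-trans (length≤value (a ∷ x) leading) (≤-reflexive eq)

  connected-0 : Connected 0
  connected-0 ex ey rewrite expansion-0 ex | expansion-0 ey = ε

  connected-2n+1 : ∀ n → Connected n → Connected (2 * n + 1)
  connected-2n+1 n connected ex ey
    with x , ex′ , refl ← proj₁ (expansion-2n+1 n) ex
       | y , ey′ , refl ← proj₁ (expansion-2n+1 n) ey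
    = EqClosure.gmap (_∷ʳ d1) (λ a → proj₂ (arcs-2n+1 n) (_ , a , refl)) (connected ex′ ey′)

  connected-4n+2 : ∀ n → Connected n → Connected (2 * n) → Connected (4 * n + 2)
  connected-4n+2 n connected-n connected-2n = connected-via-hub to-hub
    where
    x₀ = proj₁ (expansion-exists n)
    e₀ = proj₂ (expansion-exists n)
    lift₂ : ArcOf (2 * n) =[ _∷ʳ d2 ]⇒ ArcOf (4 * n + 2)
    lift₂ a = proj₂ (arcs-4n+2 n) (inj₁ (_ , a , refl))
    lift₁₀ : ArcOf n =[ (λ x → x ∷ʳ d1 ∷ʳ d0) ]⇒ ArcOf (4 * n + 2)
    lift₁₀ a = proj₂ (arcs-4n+2 n) (inj₂ (inj₁ (_ , a , refl)))
    to-hub : Expansion (4 * n + 2) w → EqClosure (ArcOf (4 * n + 2)) w (x₀ ∷ʳ d1 ∷ʳ d0)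
    to-hub e with proj₁ (expansion-4n+2 n) e
    ... | inj₁ (y , ey , refl) = EqClosure.gmap (_∷ʳ d2) lift₂ (connected-2n ey (double-expansion e₀))
                                 ◅◅ EqClosure.return (bridge-4n+2-arc e₀)
    ... | inj₂ (x , ex , refl) = EqClosure.gmap (λ x → x ∷ʳ d1 ∷ʳ d0) lift₁₀ (connected-n ex e₀)

  connected-4n+4 : ∀ n → Connected n → Connected (2 * n + 2) → Connected (4 * n + 4)
  connected-4n+4 n connected-n connected-2n+2 = connected-via-hub to-hub
    where
    x₀ = proj₁ (expansion-exists n)
    e₀ = proj₂ (expansion-exists n)
    lift₀ : ArcOf (2 * n + 2) =[ _∷ʳ d0 ]⇒ ArcOf (4 * n + 4)
    lift₀ a = proj₂ (arcs-4n+4 n) (inj₁ (_ , a , refl))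
    lift₁₂ : ArcOf n =[ (λ x → x ∷ʳ d1 ∷ʳ d2) ]⇒ ArcOf (4 * n + 4)
    lift₁₂ a = proj₂ (arcs-4n+4 n) (inj₂ (inj₁ (_ , a , refl)))
    to-hub : Expansion (4 * n + 4) w → EqClosure (ArcOf (4 * n + 4)) w (x₀ ∷ʳ d2 ∷ʳ d0)
    to-hub e with proj₁ (expansion-4n+4 n) e
    ... | inj₁ (y , ey , refl) = EqClosure.gmap (_∷ʳ d0) lift₀ (connected-2n+2 ey (expansion-∷ʳ2 e₀))
    ... | inj₂ (x , ex , refl) = EqClosure.gmap (λ x → x ∷ʳ d1 ∷ʳ d2) lift₁₂ (connected-n ex e₀)
                                 ◅◅ EqClosure.return (bridge-4n+4-arc e₀)

  connected : ∀ n → Connected n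
  connected = shape-induction Connected connected-0 connected-2n+1 connected-4n+2 connected-4n+4

  -- Counting components

  outside : List Word → Word → Bool
  outside S w = not (w ∈ᵇ S)

  new : List Word → Word → Bool
  new S w = outside S w ∧ any (adjacent w) S

  module _ (V : List Word) where

    Link : Word → Word → Set
    Link x y = y ∈ V × T (adjacent y x)

    Closed : List Word → Set
    Closed S = ∀ {w} → w ∈ V → T (any (adjacent w) S) → w ∈ S

    closed-reach : ∀ {S x y} → Closed S → x ∈ S → Star Link x y → y ∈ S
    closed-reach closed x∈S ε                       = x∈S
    closed-reach closed x∈S ((y∈V , adjacent) ◅ path) =
      closed-reach closed (closed y∈V (any⁺ _ (lose x∈S adjacent))) path

    unreached : List Word → ℕ
    unreached S = length (filterᵇ (outside S) V)

    expand-closed : ∀ {S} → Closed S → expand V S ≡ S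
    expand-closed {S} closed =
      trans (cong (S ++_) (filter-none (T? ∘ new S) (All.tabulate not-new))) (++-identityʳ S)
      where
      not-new : ∀ {w} → w ∈ V → ¬ T (new S w)
      not-new {w} w∈V new-w with w∉S , adjacent ← to T-∧ new-w =
        to (∉ᵇ⇔ w S) w∉S (closed w∈V adjacent)

    closure-closed : ∀ {S} → Closed S → ∀ k → closure k V S ≡ S
    closure-closed closed zero    = refl
    closure-closed closed (suc k) rewrite expand-closed closed = closure-closed closed k

    ⊆-closure : ∀ {S w} k → w ∈ S → w ∈ closure k V S
    ⊆-closure zero    w∈S = w∈S
    ⊆-closure (suc k) w∈S = ⊆-closure k (∈-++⁺ˡ w∈S)

    expand-progress : ∀ S → Closed S ⊎ suc (unreached (expand V S)) ≤ unreached S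
    expand-progress S with Any.any? (T? ∘ new S) V
    ... | yes some-new with w , w∈V , new-w ← find some-new =
      inj₂ (filter-length-strict (T? ∘ outside S) (T? ∘ outside (expand V S)) (λ {v} → still-unreached {v})
                                 w∈V (proj₁ (to T-∧ new-w)) (λ w∉ → to (∉ᵇ⇔ w _) w∉ w∈expand))
      where
      still-unreached : ∀ {v} → T (outside (expand V S) v) → T (outside S v)
      still-unreached {v} v∉ = from (∉ᵇ⇔ v S) (to (∉ᵇ⇔ v (expand V S)) v∉ ∘ ∈-++⁺ˡ)
      w∈expand : w ∈ expand V S
      w∈expand = ∈-++⁺ʳ S (∈-filter⁺ (T? ∘ new S) w∈V new-w)
    ... | no none-new = inj₁ closed
      where
      closed : Closed S
      closed {w} w∈V adjacent with T? (w ∈ᵇ S)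
      ... | yes w∈S = to ∈ᵇ⇔ w∈S
      ... | no  w∉S = ⊥-elim (none-new (lose w∈V (from T-∧ (from (∉ᵇ⇔ w S) (w∉S ∘ from ∈ᵇ⇔) , adjacent))))

    -- Each step either finds S closed or adds a vertex of V, so after length V steps the closure
    -- is closed or contains all of V.
    closure-progress : ∀ k S → Closed (closure k V S) ⊎ k + unreached (closure k V S) ≤ unreached S
    closure-progress zero    S = inj₂ ≤-refl
    closure-progress (suc k) S with expand-progress S
    ... | inj₁ closed = inj₁ (subst Closed (sym (closure-closed closed (suc k))) closed)
    ... | inj₂ shrinks with closure-progress k (expand V S)
    ...   | inj₁ closed = inj₁ closed
    ...   | inj₂ bound  = inj₂ (≤-trans (s≤s bound) shrinks)

    closure-complete : ∀ S → Closed (closure (length V) V S) ⊎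
                             (∀ {w} → w ∈ V → w ∈ closure (length V) V S)
    closure-complete S with closure-progress (length V) S
    ... | inj₁ closed = inj₁ closed
    ... | inj₂ bound  = inj₂ reached
      where
      S′ = closure (length V) V S
      nothing-unreached : unreached S′ ≤ 0
      nothing-unreached = +-cancelˡ-≤ (length V) _ 0
        (≤-trans bound (≤-trans (length-filter (T? ∘ outside S) V) (≤-reflexive (sym (+-identityʳ _)))))
      reached : ∀ {w} → w ∈ V → w ∈ S′
      reached {w} w∈V with T? (w ∈ᵇ S′)
      ... | yes w∈S′ = to ∈ᵇ⇔ w∈S′
      ... | no  w∉S′
        with () ← ≤-trans (∈-length (∈-filter⁺ (T? ∘ outside S′) w∈V (from (∉ᵇ⇔ w S′) (w∉S′ ∘ from ∈ᵇ⇔))))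
                          nothing-unreached

    reachable-∈-closure : ∀ {S x y} → x ∈ S → Star Link x y → y ∈ V → y ∈ closure (length V) V S
    reachable-∈-closure {S} x∈S path y∈V with closure-complete S
    ... | inj₁ closed      = closed-reach closed (⊆-closure (length V) x∈S) path
    ... | inj₂ all-reached = all-reached y∈V

  countComponents-[] : ∀ k → countComponents k [] ≡ 0
  countComponents-[] zero    = refl
  countComponents-[] (suc k) = refl

  countComponents-connected : ∀ V {u} → u ∈ V → (∀ {x y} → x ∈ V → y ∈ V → Star (Link V) x y) →
                              countComponents (length V) V ≡ 1
  countComponents-connected (u ∷ V) _ connected =
    cong suc (trans (cong (countComponents (length V)) (filter-none _ (All.tabulate reached))) (countComponents-[] _))
    where
    reached : ∀ {w} → w ∈ V → ¬ T (outside (closure (length (u ∷ V)) (u ∷ V) (u ∷ [])) w)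
    reached {w} w∈V w-unreached = to (∉ᵇ⇔ w _) w-unreached
      (reachable-∈-closure (u ∷ V) (here refl) (connected (here refl) (there w∈V)) (there w∈V))

  arc⇒link : SymClosure (ArcOf n) ⇒ Link (H n)
  arc⇒link (fwd (_  , a , ew)) = from ∈-H⇔ ew , from T-∨ (inj₂ (from ∈ᵇ⇔ (from ∈-succs⇔ a)))
  arc⇒link (bwd (ew , a , _))  = from ∈-H⇔ ew , from T-∨ (inj₁ (from ∈ᵇ⇔ (from ∈-succs⇔ a)))

  components≡1 : ∀ n → components n ≡ 1
  components≡1 n = countComponents-connected (H n) (from ∈-H⇔ (proj₂ (expansion-exists n)))
    (λ x∈ y∈ → Star.map arc⇒link (connected n (to ∈-H⇔ x∈) (to ∈-H⇔ y∈)))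

open import Defs
open import Data.Nat using (ℕ; _*_) renaming (_+_ to _+ℕ_)
open import Data.Integer using (+_; _+_; _-_)
open import Data.Integer.Properties using (pos-+)
open import Data.Integer.Tactic.RingSolver using (solve-∀)
open import Data.List using (length)
open import Data.Product using (_×_; _,_)
open import Relation.Binary.PropositionalEquality using (_≡_; refl; trans; cong; cong₂; module ≡-Reasoning)
open HyperbinaryGraph using (b-2n+1; b-4n+2; b-4n+4; arcCount-2n+1; arcCount-4n+2; arcCount-4n+4; components≡1)

v≡ : ∀ n → v n ≡ + length (arcs n) - + b n + + 1
v≡ n = cong (λ c → + length (arcs n) - + b n + + c) (components≡1 n)

v-2n+1 : ∀ n → v (2 * n +ℕ 1) ≡ v n
v-2n+1 n = begin
  v (2 * n +ℕ 1)
    ≡⟨ v≡ (2 * n +ℕ 1) ⟩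
  + length (arcs (2 * n +ℕ 1)) - + b (2 * n +ℕ 1) + + 1
    ≡⟨ cong₂ (λ a c → + a - + c + + 1) (arcCount-2n+1 n) (b-2n+1 n) ⟩
  + length (arcs n) - + b n + + 1
    ≡⟨ v≡ n ⟨
  v n
    ∎
  where open ≡-Reasoning

v-join : ∀ m k n → length (arcs m) ≡ length (arcs k) +ℕ (length (arcs n) +ℕ b n) → b m ≡ b k +ℕ b n →
         v m ≡ v k + v n + + b n - + 1
v-join m k n arcs-m b-m = begin
  v m
    ≡⟨ v≡ m ⟩
  + length (arcs m) - + b m + + 1
    ≡⟨ cong₂ (λ a c → + a - + c + + 1) arcs-m b-m ⟩
  + (aₖ +ℕ (aₙ +ℕ bₙ)) - + (bₖ +ℕ bₙ) + + 1
    ≡⟨ cong₂ (λ a c → a - c + + 1) split-arcs (pos-+ bₖ bₙ) ⟩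
  + aₖ + (+ aₙ + + bₙ) - (+ bₖ + + bₙ) + + 1
    ≡⟨ rearrange (+ aₖ) (+ bₖ) (+ aₙ) (+ bₙ) ⟩
  (+ aₖ - + bₖ + + 1) + (+ aₙ - + bₙ + + 1) + + bₙ - + 1
    ≡⟨ cong₂ (λ x y → x + y + + bₙ - + 1) (v≡ k) (v≡ n) ⟨
  v k + v n + + b n - + 1
    ∎
  where
  open ≡-Reasoning
  aₖ = length (arcs k)
  aₙ = length (arcs n)
  bₖ = b k
  bₙ = b n
  split-arcs : + (aₖ +ℕ (aₙ +ℕ bₙ)) ≡ + aₖ + (+ aₙ + + bₙ)
  split-arcs = trans (pos-+ aₖ _) (cong (λ t → + aₖ + t) (pos-+ aₙ bₙ))
  rearrange : ∀ a b a′ c → a + (a′ + c) - (b + c) + + 1 ≡ (a - b + + 1) + (a′ - c + + 1) + c - + 1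
  rearrange = solve-∀

mainTheorem1 :
    (v 0 ≡ + 0)
    × (∀ (n : ℕ) → v (2 * n +ℕ 1) ≡ v n)
    × (∀ (n : ℕ) → v (4 * n +ℕ 2) ≡ v (2 * n) + v n + + b n - + 1)
    × (∀ (n : ℕ) → v (4 * n +ℕ 4) ≡ v (2 * n +ℕ 2) + v n + + b n - + 1)
mainTheorem1 =
    refl
  , v-2n+1
  , (λ n → v-join (4 * n +ℕ 2) (2 * n) n (arcCount-4n+2 n) (b-4n+2 n))
  , (λ n → v-join (4 * n +ℕ 4) (2 * n +ℕ 2) n (arcCount-4n+4 n) (b-4n+4 n))
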